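{- Let $N$ be a network on $X$ containing a cherry $\{x,y\}$, and let $N'$ be the network on $(X\setminus\{x,y\})\cup\{z\}$ obtained by reducing the cherry $\{x,y\}$ to a leaf $z\notin X$. Then $N$ is reconstructible from its shortest distance matrix if and only if $N'$ is reconstructible from its shortest distance matrix.
   Context: A network on a finite set $X$ with $|X|\ge 2$ is a finite, simple, connected, undirected, unweighted graph with at least two degree-$1$ vertices (leaves), leaves bijectively labelled by $X$, all other vertices of degree $3$; standing assumption: every cut-edge separates $X$ into two non-empty parts and distinct cut-edges induce distinct bipartitions of $X$. A cherry is a set of two leaves $\{x,y\}$ with a common neighbour. Reducing the cherry $\{x,y\}$ to a leaf $z$ means deleting $x$ and $y$ and labelling their common neighbour (now of degree $1$) by $z$. $d^N_m$ is the shortest-path distance (number of edges); $\mathcal{D}_m(N)=(d^N_m(a,b))_{a,b}$ over the leaves. $N$ is reconstructible from its shortest distance matrix if every network realizing $\mathcal{D}_m(N)$ is isomorphic to $N$ via a graph isomorphism preserving leaf labels. -}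

module Defs where

open import Data.Nat using (ℕ; zero; suc; _≤_)
open import Data.Fin using (Fin)
open import Data.Bool using (Bool; true; false; if_then_else_; not; _∧_; T)
open import Data.List using (List; map; allFin)
open import Data.Nat.ListAction using (sum)
open import Data.Maybe using (Maybe; nothing; just)
open import Data.Product using (Σ; ∃; ∃-syntax; _×_; _,_)
open import Data.Sum using (_⊎_)
open import Relation.Nullary using (¬_)
open import Relation.Nullary.Decidable using (⌊_⌋)
open import Relation.Binary.Definitions using (DecidableEquality)
open import Relation.Binary.PropositionalEquality using (_≡_; _≢_)
open import Function.Bundles using (_↔_; Inverse; _⇔_)

Adj : ∀ {m} → (Fin m → Fin m → Bool) → Fin m → Fin m → Set
Adj E u v = E u v ≡ true

AdjWithout : ∀ {m} → (Fin m → Fin m → Bool) → Fin m → Fin m → Fin m → Fin m → Set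
AdjWithout E a b u v = (E u v ≡ true) × ¬ (u ≡ a × v ≡ b) × ¬ (u ≡ b × v ≡ a)

data Walk {m : ℕ} (R : Fin m → Fin m → Set) : Fin m → Fin m → ℕ → Set where
  here : ∀ {v} → Walk R v v 0
  step : ∀ {u v w n} → R u v → Walk R v w n → Walk R u w (suc n)

deg : ∀ {m} → (Fin m → Fin m → Bool) → Fin m → ℕ
deg {m} E v = sum (map (λ u → if E v u then 1 else 0) (allFin m))

IsCutEdge : ∀ {m} → (Fin m → Fin m → Bool) → Fin m → Fin m → Set
IsCutEdge E u v = (E u v ≡ true) × ¬ (∃[ n ] Walk (AdjWithout E u v) u v n)

SideOf : ∀ {m} → (Fin m → Fin m → Bool) → Fin m → Fin m → Fin m → Set
SideOf E s t w = ∃[ n ] Walk (AdjWithout E s t) s w n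

record Network (X : Set) (m : ℕ) : Set where
  field
    E          : Fin m → Fin m → Bool
    E-sym      : ∀ u v → E u v ≡ E v u
    E-irrefl   : ∀ v → E v v ≡ false
    connected  : ∀ u v → ∃[ n ] Walk (Adj E) u v n
    label      : X → Fin m
    label-inj  : ∀ a b → label a ≡ label b → a ≡ b
    label-deg  : ∀ a → deg E (label a) ≡ 1
    other-deg  : ∀ v → (∃[ a ] label a ≡ v) ⊎ (deg E v ≡ 3)
    two-leaves : Σ X λ a → Σ X λ b → a ≢ b
    cut-nonempty : ∀ u v → IsCutEdge E u v →
                   (∃[ a ] SideOf E u v (label a)) × (∃[ b ] SideOf E v u (label b))
    cut-distinct : ∀ u v u' v' → IsCutEdge E u v → IsCutEdge E u' v' →
                   ((∀ a → SideOf E u v (label a) ⇔ SideOf E u' v' (label a))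
                    ⊎ (∀ a → SideOf E u v (label a) ⇔ SideOf E v' u' (label a))) →
                   (u ≡ u' × v ≡ v') ⊎ (u ≡ v' × v ≡ u')

open Network public

IsDist : ∀ {X m} → Network X m → Fin m → Fin m → ℕ → Set
IsDist N u v k = Walk (Adj (E N)) u v k × (∀ n → Walk (Adj (E N)) u v n → k ≤ n)

SameDistMatrix : ∀ {X m k} → Network X m → Network X k → Set
SameDistMatrix N M = ∀ a b d → IsDist N (label N a) (label N b) d ⇔ IsDist M (label M a) (label M b) d

Isomorphic : ∀ {X m k} → Network X m → Network X k → Set
Isomorphic {m = m} {k = k} N M =
  Σ (Fin m ↔ Fin k) λ φ →
    (∀ u v → E M (Inverse.to φ u) (Inverse.to φ v) ≡ E N u v) ×
    (∀ a → Inverse.to φ (label N a) ≡ label M a)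

Reconstructible : ∀ {X m} → Network X m → Set
Reconstructible {X} N = ∀ {k} (M : Network X k) → SameDistMatrix N M → Isomorphic N M

IsCherry : ∀ {X m} → Network X m → X → X → Fin m → Set
IsCherry N x y p = x ≢ y × Adj (E N) (label N x) p × Adj (E N) (label N y) p

-- the label set (X \ {x,y}) ∪ {z}: nothing plays the role of the new leaf z ∉ X
Reduced : {X : Set} → DecidableEquality X → X → X → Set
Reduced {X} _≟_ x y = Maybe (Σ X λ a → T (not ⌊ a ≟ x ⌋ ∧ not ⌊ a ≟ y ⌋))

-- N' is (up to label-preserving isomorphism) the network obtained from N by
-- deleting the leaves x,y and labelling their common neighbour p by z = nothing:
-- ι identifies the vertices of N' with the vertices of N other than x,y,
-- preserving adjacency and labels.
record CherryReduction {X : Set} {m m' : ℕ} (_≟_ : DecidableEquality X)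
         (N : Network X m) (x y : X) (p : Fin m)
         (N' : Network (Reduced _≟_ x y) m') : Set where
  field
    ι        : Fin m' → Fin m
    ι-inj    : ∀ u v → ι u ≡ ι v → u ≡ v
    ι-avoid  : ∀ u → ι u ≢ label N x × ι u ≢ label N y
    ι-onto   : ∀ v → v ≢ label N x → v ≢ label N y → ∃[ u ] ι u ≡ v
    ι-adj    : ∀ u v → E N (ι u) (ι v) ≡ E N' u v
    ι-z      : ι (label N' nothing) ≡ p
    ι-label  : ∀ a h → ι (label N' (just (a , h))) ≡ label N a

{-# OPTIONS --safe #-}
-- Deleting the cherry {x, y} and labelling its common neighbour by z keeps the distances between the
-- remaining leaves, turns d(x, b) = d(y, b) into d(z, b) + 1, and d(x, y) = 2. So in a network M with
-- the distance matrix of N the leaves x and y are at distance 2, i.e. form a cherry of M whose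
-- reduction M′ has the distance matrix of N′; conversely, hanging x and y on the vertex z of a network
-- M′ with the distance matrix of N′ yields such an M. A label-preserving isomorphism between the
-- reductions extends to the networks by fixing x and y, and one between the networks restricts to the
-- reductions.
module Submission where

open import Defs
open import Level using (0ℓ)
open import Data.Bool using (Bool; true; false; if_then_else_; not; _∧_; T)
open import Data.Bool.Properties using (T-∧; T-irrelevant; ⇔→≡)
open import Data.Empty using (⊥; ⊥-elim)
open import Data.Fin using (Fin; zero; suc; punchIn; punchOut)
import Data.Fin.Properties as Fin
open import Data.Fin.Properties using (punchIn-injective; punchInᵢ≢i; punchIn-punchOut) renaming (_≟_ to _≟ᶠ_)
open import Data.List using (tabulate)
open import Data.List.Properties using (map-tabulate)
open import Data.Maybe using (nothing; just; maybe)
open import Data.Nat using (ℕ; zero; suc; _+_; _≤_; z≤n; s≤s; s≤s⁻¹)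
import Data.Nat.ListAction as List
open import Data.Nat.Properties
  using (≤-trans; ≤-antisym; n≤1+n; n≤0⇒n≡0; m+n≡0⇒m≡0; 1+n≢0; suc-injective; +-0-commutativeMonoid)
open import Algebra.Properties.CommutativeMonoid.Sum +-0-commutativeMonoid
  using (sum; sum-remove; sum-cong-≗; sum-replicate-zero)
open import Data.Product using (Σ; ∃; ∃-syntax; _×_; _,_; proj₁; proj₂) renaming (map to map×)
open import Data.Sum using (_⊎_; inj₁; inj₂; swap) renaming (map to map⊎)
open import Function using (_∘_)
open import Function.Bundles using (_⇔_; mk⇔; Equivalence; Inverse; mk↔ₛ′)
open import Function.Construct.Identity using (⇔-id)
open import Function.Properties.Equivalence using (⇔-setoid) renaming (sym to ⇔-sym; trans to ⇔-trans)
open import Relation.Binary.Core using (_=[_]⇒_)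
open import Relation.Binary.Definitions using (DecidableEquality)
open import Relation.Binary.PropositionalEquality
  using (_≡_; _≢_; refl; sym; trans; cong; cong₂; subst; subst₂; module ≡-Reasoning)
import Relation.Binary.Reasoning.Setoid as SetoidReasoning
open import Relation.Nullary using (¬_; Dec; yes; no; does)
open import Relation.Nullary.Decidable
  using (⌊_⌋; dec-true; dec-false; fromWitnessFalse; toWitnessFalse; decidable-stable)

open Equivalence using (to; from)

left-inverse⇒preimage-unique : ∀ {A B : Set} {f : A → B} {g : B → A} → (∀ a → g (f a) ≡ a) →
                               ∀ {a a′ b} → f a ≡ b → f a′ ≡ b → a′ ≡ a
left-inverse⇒preimage-unique {f = f} {g} gf≗id {a} {a′} fa≡b fa′≡b = begin
  a′          ≡⟨ gf≗id a′ ⟨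
  g (f a′)    ≡⟨ cong g (trans fa′≡b (sym fa≡b)) ⟩
  g (f a)     ≡⟨ gf≗id a ⟩
  a           ∎
  where open ≡-Reasoning

does-true : ∀ {P : Set} (d : Dec P) → does d ≡ true → P
does-true (yes p) _ = p
does-true (no _) ()

subst-⇔ : ∀ {A : Set} (P : A → Set) {a b} → a ≡ b → P a ⇔ P b
subst-⇔ P refl = ⇔-id _

-- Walks, distances and cut-edges

Graph : ℕ → Set
Graph k = Fin k → Fin k → Bool

module _ {m : ℕ} {R : Fin m → Fin m → Set} where

  walk-snoc : ∀ {u v w n} → Walk R u v n → R v w → Walk R u w (suc n)
  walk-snoc here r = step r here
  walk-snoc (step r′ W) r = step r′ (walk-snoc W r)

  walk-++ : ∀ {u v w n n′} → Walk R u v n → Walk R v w n′ → Walk R u w (n + n′)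
  walk-++ here W′ = W′
  walk-++ (step r W) W′ = step r (walk-++ W W′)

  walk-reverse : (∀ {u v} → R u v → R v u) → ∀ {u v n} → Walk R u v n → Walk R v u n
  walk-reverse R-sym here = here
  walk-reverse R-sym (step r W) = walk-snoc (walk-reverse R-sym W) (R-sym r)

module _ {m m′ : ℕ} {R : Fin m → Fin m → Set} {R′ : Fin m′ → Fin m′ → Set} (f : Fin m → Fin m′) where

  walk-map : R =[ f ]⇒ R′ → ∀ {u v n} → Walk R u v n → Walk R′ (f u) (f v) n
  walk-map h here = here
  walk-map h (step r W) = step (h r) (walk-map h W)

  walk-contract : (∀ {u v} → R u v → R′ (f u) (f v) ⊎ f u ≡ f v) →
                  ∀ {s t n} → Walk R s t n → ∃[ n′ ] n′ ≤ n × Walk R′ (f s) (f t) n′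
  walk-contract h here = 0 , z≤n , here
  walk-contract h {t = t} (step r W) with walk-contract h W | h r
  ... | n′ , n′≤n , W′ | inj₁ r′ = suc n′ , s≤s n′≤n , step r′ W′
  ... | n′ , n′≤n , W′ | inj₂ eq =
    n′ , ≤-trans n′≤n (n≤1+n _) , subst (λ a → Walk R′ a (f t) n′) (sym eq) W′

Dist : ∀ {k} → Graph k → Fin k → Fin k → ℕ → Set
Dist E u v d = Walk (Adj E) u v d × (∀ n → Walk (Adj E) u v n → d ≤ n)

Connected : ∀ {k} → Graph k → Set
Connected E = ∀ u v → ∃[ n ] Walk (Adj E) u v n

Symmetric : ∀ {k} → Graph k → Set
Symmetric E = ∀ u v → E u v ≡ E v u

module _ {k : ℕ} {E : Graph k} where

  Adj-sym : Symmetric E → ∀ {u v} → Adj E u v → Adj E v u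
  Adj-sym E-sym {u} {v} e = trans (E-sym v u) e

  AdjWithout-sym : Symmetric E → ∀ {a b u v} → AdjWithout E a b u v → AdjWithout E a b v u
  AdjWithout-sym E-sym (e , ≢ab , ≢ba) =
    Adj-sym E-sym e , (λ (u≡a , v≡b) → ≢ba (v≡b , u≡a)) , (λ (u≡b , v≡a) → ≢ab (v≡a , u≡b))

  AdjWithout-flip : ∀ {a b u v} → AdjWithout E a b u v → AdjWithout E b a u v
  AdjWithout-flip (e , ≢ab , ≢ba) = e , ≢ba , ≢ab

  dist-sym : Symmetric E → ∀ {u v d} → Dist E u v d ⇔ Dist E v u d
  dist-sym E-sym = mk⇔ reverse reverse
    where
    reverse : ∀ {u v d} → Dist E u v d → Dist E v u d
    reverse (W , minimal) = walk-reverse (Adj-sym E-sym) W , λ n W′ → minimal n (walk-reverse (Adj-sym E-sym) W′)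

  dist-cong : ∀ {u u′ v v′ d} → u ≡ u′ → v ≡ v′ → Dist E u v d ⇔ Dist E u′ v′ d
  dist-cong refl refl = ⇔-id _

  dist-self : ∀ {u d} → Dist E u u d ⇔ d ≡ 0
  dist-self = mk⇔ (λ { (_ , minimal) → n≤0⇒n≡0 (minimal 0 here) }) (λ { refl → here , λ _ _ → z≤n })

  IsCutEdge-sym : Symmetric E → ∀ {u v} → IsCutEdge E u v → IsCutEdge E v u
  IsCutEdge-sym E-sym (e , disconnected) =
    Adj-sym E-sym e ,
    λ (n , W) → disconnected (n , walk-reverse (AdjWithout-sym E-sym) (walk-map (λ w → w) AdjWithout-flip W))

SameBipartition : ∀ {A : Set} {k} → Graph k → (A → Fin k) → (u v u′ v′ : Fin k) → Set
SameBipartition E ℓ u v u′ v′ = ∀ a → SideOf E u v (ℓ a) ⇔ SideOf E u′ v′ (ℓ a)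

-- Pendant vertices and degrees

Pendant : ∀ {k} → Graph k → Fin k → Fin k → Set
Pendant E ℓ p = Adj E ℓ p × (∀ w → Adj E ℓ w → w ≡ p)

module _ {k : ℕ} {E : Graph k} {ℓ p : Fin k} (pendant : Pendant E ℓ p) where

  open Σ pendant renaming (proj₁ to ℓp; proj₂ to only-p)

  pendant-row : ∀ {v} → E ℓ v ≡ true ⇔ v ≡ p
  pendant-row = mk⇔ (only-p _) (λ { refl → ℓp })

  walk-from-pendant : ∀ {t n} → Walk (Adj E) ℓ t (suc n) → Walk (Adj E) p t n
  walk-from-pendant (step e W) = subst (λ a → Walk (Adj E) a _ _) (only-p _ e) W

  dist-from-pendant : ∀ {t d} → t ≢ ℓ → Dist E ℓ t (suc d) ⇔ Dist E p t d
  dist-from-pendant {t} t≢ℓ = mk⇔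
    (λ (W , minimal) → walk-from-pendant W , λ n W′ → s≤s⁻¹ (minimal (suc n) (step ℓp W′)))
    (λ (W , minimal) → step ℓp W , λ { zero here → ⊥-elim (t≢ℓ refl)
                                      ; (suc n) W′ → s≤s (minimal n (walk-from-pendant W′)) })

  ¬dist-from-pendant-0 : ∀ {t} → t ≢ ℓ → ¬ Dist E ℓ t 0
  ¬dist-from-pendant-0 t≢ℓ (here , _) = t≢ℓ refl

  dist-pendant-pendant : ∀ {ℓ′} → ℓ ≢ ℓ′ → p ≢ ℓ′ → Adj E p ℓ′ → ∀ {d} → Dist E ℓ ℓ′ d ⇔ d ≡ 2
  dist-pendant-pendant {ℓ′} ℓ≢ℓ′ p≢ℓ′ pℓ′ =
    mk⇔ (λ (W , minimal) → ≤-antisym (minimal 2 path) (two≤ W)) (λ { refl → path , λ n → two≤ })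
    where
    path : Walk (Adj E) ℓ ℓ′ 2
    path = step ℓp (step pℓ′ here)
    two≤ : ∀ {n} → Walk (Adj E) ℓ ℓ′ n → 2 ≤ n
    two≤ here = ⊥-elim (ℓ≢ℓ′ refl)
    two≤ (step e here) = ⊥-elim (p≢ℓ′ (sym (only-p _ e)))
    two≤ (step _ (step _ _)) = s≤s (s≤s z≤n)

  pendant-side : ∀ {t} → SideOf E ℓ p t → t ≡ ℓ
  pendant-side (zero , here) = refl
  pendant-side (suc n , step (e , ≢ℓp , _) W) = ⊥-elim (≢ℓp (refl , only-p _ e))

  ¬pendant-opposite-side : Symmetric E → p ≢ ℓ → ¬ SideOf E p ℓ ℓ
  ¬pendant-opposite-side E-sym p≢ℓ (n , W) = avoid p≢ℓ W
    where
    avoid : ∀ {s n} → s ≢ ℓ → Walk (AdjWithout E p ℓ) s ℓ n → ⊥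
    avoid s≢ℓ here = s≢ℓ refl
    avoid {s} s≢ℓ (step {v = w} (e , ≢pℓ , _) W) with w ≟ᶠ ℓ
    ... | yes refl = ≢pℓ (only-p s (Adj-sym E-sym e) , refl)
    ... | no w≢ℓ = avoid w≢ℓ W

indicator : Bool → ℕ
indicator b = if b then 1 else 0

deg≡sum : ∀ {m} (E : Graph m) v → deg E v ≡ sum (indicator ∘ E v)
deg≡sum E v = trans (cong List.sum (map-tabulate (λ u → u) (indicator ∘ E v))) (sum-tabulate (indicator ∘ E v))
  where
  sum-tabulate : ∀ {n} (f : Fin n → ℕ) → List.sum (tabulate f) ≡ sum f
  sum-tabulate {zero} f = refl
  sum-tabulate {suc n} f = cong (f zero +_) (sum-tabulate (f ∘ suc))

sum≡0⇒≡0 : ∀ {n} (f : Fin n → ℕ) → sum f ≡ 0 → ∀ i → f i ≡ 0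
sum≡0⇒≡0 {suc n} f Σf≡0 i = m+n≡0⇒m≡0 (f i) (trans (sym (sum-remove {i = i} f)) Σf≡0)

sum-zero : ∀ {n} (f : Fin n → ℕ) → (∀ i → f i ≡ 0) → sum f ≡ 0
sum-zero {n} f f≡0 = trans (sum-cong-≗ f≡0) (sum-replicate-zero n)

indicator-true : ∀ {b} → b ≡ true → indicator b ≡ 1
indicator-true refl = refl

indicator-false : ∀ {b} → b ≢ true → indicator b ≡ 0
indicator-false {true} b≢true = ⊥-elim (b≢true refl)
indicator-false {false} _ = refl

deg≡1⇒neighbour-unique : ∀ {m} (E : Graph m) v → deg E v ≡ 1 → ∀ a b → Adj E v a → Adj E v b → a ≡ b
deg≡1⇒neighbour-unique {suc m} E v deg≡1 a b va vb with a ≟ᶠ b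
... | yes a≡b = a≡b
... | no a≢b = ⊥-elim (1+n≢0 (trans (sym (indicator-true vb)) b-term≡0))
  where
  open ≡-Reasoning
  f = indicator ∘ E v
  others≡0 : sum (f ∘ punchIn a) ≡ 0
  others≡0 = suc-injective (begin
    1 + sum (f ∘ punchIn a)    ≡⟨ cong (_+ sum (f ∘ punchIn a)) (indicator-true va) ⟨
    f a + sum (f ∘ punchIn a)  ≡⟨ sum-remove {i = a} f ⟨
    sum f                      ≡⟨ deg≡sum E v ⟨
    deg E v                    ≡⟨ deg≡1 ⟩
    1                          ∎)
  b-term≡0 : f b ≡ 0
  b-term≡0 = subst (λ w → f w ≡ 0) (punchIn-punchOut a≢b) (sum≡0⇒≡0 (f ∘ punchIn a) others≡0 (punchOut a≢b))

deg-punchIn² : ∀ {k} (E : Graph (suc (suc k))) (i : Fin (suc (suc k))) (j : Fin (suc k)) (u : Fin k) →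
               let ι = λ w → punchIn i (punchIn j w) in
               deg E (ι u) ≡ indicator (E (ι u) i) + (indicator (E (ι u) (punchIn i j))
                                                    + deg (λ a b → E (ι a) (ι b)) u)
deg-punchIn² E i j u = begin
  deg E (ι u)                              ≡⟨ deg≡sum E (ι u) ⟩
  sum f                                    ≡⟨ sum-remove {i = i} f ⟩
  f i + sum (f ∘ punchIn i)                ≡⟨ cong (f i +_) (sum-remove {i = j} (f ∘ punchIn i)) ⟩
  f i + (f (punchIn i j) + sum (f ∘ ι))    ≡⟨ cong (λ s → f i + (f (punchIn i j) + s)) (deg≡sum E′ u) ⟨
  f i + (f (punchIn i j) + deg E′ u)       ∎
  where
  open ≡-Reasoning
  ι = λ w → punchIn i (punchIn j w)
  E′ = λ a b → E (ι a) (ι b)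
  f = indicator ∘ E (ι u)

sum-indicator-≟ : ∀ {n} (q : Fin n) → sum (λ v → indicator (does (v ≟ᶠ q))) ≡ 1
sum-indicator-≟ {suc n} q = begin
  sum f                         ≡⟨ sum-remove {i = q} f ⟩
  f q + sum (f ∘ punchIn q)     ≡⟨ cong₂ _+_ (cong indicator (dec-true (q ≟ᶠ q) refl)) (sum-zero _ others) ⟩
  1 + 0                         ∎
  where
  open ≡-Reasoning
  f = λ v → indicator (does (v ≟ᶠ q))
  others : ∀ v → f (punchIn q v) ≡ 0
  others v = cong indicator (dec-false (punchIn q v ≟ᶠ q) (punchInᵢ≢i q v))

-- Deleting two pendant vertices with a common neighbour

record CherryDeletion {k k′ : ℕ} (E : Graph k) (E′ : Graph k′) (ℓx ℓy : Fin k) (p′ : Fin k′) : Set where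
  field
    symmetric   : Symmetric E
    ι           : Fin k′ → Fin k
    ι-injective : ∀ u v → ι u ≡ ι v → u ≡ v
    ι≢ℓx        : ∀ u → ι u ≢ ℓx
    ι≢ℓy        : ∀ u → ι u ≢ ℓy
    ι-onto      : ∀ v → v ≢ ℓx → v ≢ ℓy → ∃[ u ] ι u ≡ v
    ι-adj       : ∀ u v → E (ι u) (ι v) ≡ E′ u v
    ℓx-pendant  : Pendant E ℓx (ι p′)
    ℓy-pendant  : Pendant E ℓy (ι p′)
    ℓx≢ℓy       : ℓx ≢ ℓy

module CherryDeletionProperties {k k′ : ℕ} {E : Graph k} {E′ : Graph k′} {ℓx ℓy : Fin k} {p′ : Fin k′}
                                (D : CherryDeletion E E′ ℓx ℓy p′) where
  open CherryDeletion D public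

  p : Fin k
  p = ι p′

  data Kind (v : Fin k) : Set where
    is-ℓx : v ≡ ℓx → Kind v
    is-ℓy : v ≡ ℓy → Kind v
    is-ι  : (u : Fin k′) → ι u ≡ v → Kind v

  kind : ∀ v → Kind v
  kind v with v ≟ᶠ ℓx | v ≟ᶠ ℓy
  ... | yes v≡ℓx | _       = is-ℓx v≡ℓx
  ... | no _     | yes v≡ℓy = is-ℓy v≡ℓy
  ... | no v≢ℓx  | no v≢ℓy  = is-ι (proj₁ (ι-onto v v≢ℓx v≢ℓy)) (proj₂ (ι-onto v v≢ℓx v≢ℓy))

  module _ {A : Set} (a b : A) (g : Fin k′ → A) where

    byKind : Fin k → A
    byKind v with kind v
    ... | is-ℓx _ = a
    ... | is-ℓy _ = b
    ... | is-ι u _ = g u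

    byKind-ℓx : byKind ℓx ≡ a
    byKind-ℓx with kind ℓx
    ... | is-ℓx _ = refl
    ... | is-ℓy ℓx≡ℓy = ⊥-elim (ℓx≢ℓy ℓx≡ℓy)
    ... | is-ι u ιu≡ℓx = ⊥-elim (ι≢ℓx u ιu≡ℓx)

    byKind-ℓy : byKind ℓy ≡ b
    byKind-ℓy with kind ℓy
    ... | is-ℓx ℓy≡ℓx = ⊥-elim (ℓx≢ℓy (sym ℓy≡ℓx))
    ... | is-ℓy _ = refl
    ... | is-ι u ιu≡ℓy = ⊥-elim (ι≢ℓy u ιu≡ℓy)

    byKind-ι : ∀ u → byKind (ι u) ≡ g u
    byKind-ι u with kind (ι u)
    ... | is-ℓx ιu≡ℓx = ⊥-elim (ι≢ℓx u ιu≡ℓx)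
    ... | is-ℓy ιu≡ℓy = ⊥-elim (ι≢ℓy u ιu≡ℓy)
    ... | is-ι u′ ιu′≡ιu = cong g (ι-injective u′ u ιu′≡ιu)

  kind-elim : (P : Fin k → Set) → P ℓx → P ℓy → (∀ u → P (ι u)) → ∀ v → P v
  kind-elim P Pℓx Pℓy Pι v with kind v
  ... | is-ℓx refl = Pℓx
  ... | is-ℓy refl = Pℓy
  ... | is-ι u refl = Pι u

  π : Fin k → Fin k′
  π = byKind p′ p′ (λ u → u)

  π-ι : ∀ u → π (ι u) ≡ u
  π-ι = byKind-ι p′ p′ (λ u → u)

  π-ℓx : π ℓx ≡ p′
  π-ℓx = byKind-ℓx p′ p′ (λ u → u)

  π-ℓy : π ℓy ≡ p′
  π-ℓy = byKind-ℓy p′ p′ (λ u → u)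

  ι-π-image : ∀ {u v} → ι u ≡ v → ι (π v) ≡ v
  ι-π-image {u} refl = cong ι (π-ι u)

  ι-π : ∀ v → v ≢ ℓx → v ≢ ℓy → ι (π v) ≡ v
  ι-π v v≢ℓx v≢ℓy = ι-π-image (proj₂ (ι-onto v v≢ℓx v≢ℓy))

  p≢ℓy : p ≢ ℓy
  p≢ℓy = ι≢ℓy p′

  π-neighbour : ∀ {ℓ w} → Pendant E ℓ p → Adj E ℓ w → π w ≡ p′
  π-neighbour (_ , only-p) e = trans (cong π (only-p _ e)) (π-ι p′)

  pendant-edge-collapses : ∀ {ℓ s w} → Pendant E ℓ p → π ℓ ≡ p′ → s ≡ ℓ → Adj E s w → π s ≡ π w
  pendant-edge-collapses pendant πℓ refl e = trans πℓ (sym (π-neighbour pendant e))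

  edge-image : ∀ {s w} → Adj E s w → π s ≡ π w ⊎ (ι (π s) ≡ s × ι (π w) ≡ w)
  edge-image {s} {w} e = cases (kind s) (kind w)
    where
    cases : Kind s → Kind w → π s ≡ π w ⊎ (ι (π s) ≡ s × ι (π w) ≡ w)
    cases (is-ℓx s≡ℓx) _ = inj₁ (pendant-edge-collapses ℓx-pendant π-ℓx s≡ℓx e)
    cases (is-ℓy s≡ℓy) _ = inj₁ (pendant-edge-collapses ℓy-pendant π-ℓy s≡ℓy e)
    cases (is-ι _ _) (is-ℓx w≡ℓx) =
      inj₁ (sym (pendant-edge-collapses ℓx-pendant π-ℓx w≡ℓx (Adj-sym symmetric e)))
    cases (is-ι _ _) (is-ℓy w≡ℓy) =
      inj₁ (sym (pendant-edge-collapses ℓy-pendant π-ℓy w≡ℓy (Adj-sym symmetric e)))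
    cases (is-ι _ ιa≡s) (is-ι _ ιb≡w) = inj₂ (ι-π-image ιa≡s , ι-π-image ιb≡w)

  lift-Adj : Adj E′ =[ ι ]⇒ Adj E
  lift-Adj {u} {v} e = trans (ι-adj u v) e

  lift-AdjWithout : ∀ {a b} → AdjWithout E′ a b =[ ι ]⇒ AdjWithout E (ι a) (ι b)
  lift-AdjWithout (e , ≢ab , ≢ba) =
    lift-Adj e , (λ (ιu≡ιa , ιv≡ιb) → ≢ab (ι-injective _ _ ιu≡ιa , ι-injective _ _ ιv≡ιb))
               , (λ (ιu≡ιb , ιv≡ιa) → ≢ba (ι-injective _ _ ιu≡ιb , ι-injective _ _ ιv≡ιa))

  contract-Adj : ∀ {s w} → Adj E s w → Adj E′ (π s) (π w) ⊎ π s ≡ π w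
  contract-Adj e with edge-image e
  ... | inj₁ collapsed = inj₂ collapsed
  ... | inj₂ (ιπs≡s , ιπw≡w) = inj₁ (trans (sym (ι-adj _ _)) (subst₂ (Adj E) (sym ιπs≡s) (sym ιπw≡w) e))

  contract-AdjWithout : ∀ {a b s w} → AdjWithout E (ι a) (ι b) s w → AdjWithout E′ a b (π s) (π w) ⊎ π s ≡ π w
  contract-AdjWithout (e , ≢ab , ≢ba) with edge-image e
  ... | inj₁ collapsed = inj₂ collapsed
  ... | inj₂ (ιπs≡s , ιπw≡w) = inj₁
    ( trans (sym (ι-adj _ _)) (subst₂ (Adj E) (sym ιπs≡s) (sym ιπw≡w) e)
    , (λ (πs≡a , πw≡b) → ≢ab (trans (sym ιπs≡s) (cong ι πs≡a) , trans (sym ιπw≡w) (cong ι πw≡b)))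
    , (λ (πs≡b , πw≡a) → ≢ba (trans (sym ιπs≡s) (cong ι πs≡b) , trans (sym ιπw≡w) (cong ι πw≡a))))

  lift-walk : ∀ {u v n} → Walk (Adj E′) u v n → Walk (Adj E) (ι u) (ι v) n
  lift-walk = walk-map ι lift-Adj

  project-walk : ∀ {u v n} → Walk (Adj E) (ι u) (ι v) n → ∃[ n′ ] n′ ≤ n × Walk (Adj E′) u v n′
  project-walk {u} {v} W with walk-contract π contract-Adj W
  ... | n′ , n′≤n , W′ = n′ , n′≤n , subst₂ (λ a b → Walk (Adj E′) a b n′) (π-ι u) (π-ι v) W′

  dist-ι : ∀ {u v d} → Dist E (ι u) (ι v) d ⇔ Dist E′ u v d
  dist-ι {u} {v} = mk⇔
    (λ (W , minimal) → let (n′ , n′≤d , W′) = project-walk W in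
       subst (Walk (Adj E′) u v) (≤-antisym n′≤d (minimal n′ (lift-walk W′))) W′ ,
       λ n W″ → minimal n (lift-walk W″))
    (λ (W′ , minimal′) → lift-walk W′ ,
       λ n W → let (n′ , n′≤n , W″) = project-walk W in ≤-trans (minimal′ n′ W″) n′≤n)

  side-project : ∀ {a b t} → SideOf E (ι a) (ι b) t → SideOf E′ a b (π t)
  side-project {a} {b} {t} (n , W) with walk-contract π contract-AdjWithout W
  ... | n′ , _ , W′ = n′ , subst (λ s → Walk (AdjWithout E′ a b) s (π t) n′) (π-ι a) W′

  side-lift : ∀ {a b t} → SideOf E′ a b (π t) → SideOf E (ι a) (ι b) t
  side-lift {a} {b} {t} (n , W′) = cases (kind t)
    where
    W : Walk (AdjWithout E (ι a) (ι b)) (ι a) (ι (π t)) n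
    W = walk-map ι lift-AdjWithout W′
    through-pendant : ∀ {ℓ} → Pendant E ℓ p → π ℓ ≡ p′ → (∀ u → ι u ≢ ℓ) → t ≡ ℓ →
                      SideOf E (ι a) (ι b) t
    through-pendant (ℓp , _) πℓ ι≢ℓ refl =
      suc n , walk-snoc (subst (λ v → Walk (AdjWithout E (ι a) (ι b)) (ι a) v n) (cong ι πℓ) W)
                        (Adj-sym symmetric ℓp , ι≢ℓ b ∘ sym ∘ proj₂ , ι≢ℓ a ∘ sym ∘ proj₂)
    cases : Kind t → SideOf E (ι a) (ι b) t
    cases (is-ℓx t≡ℓx) = through-pendant ℓx-pendant π-ℓx ι≢ℓx t≡ℓx
    cases (is-ℓy t≡ℓy) = through-pendant ℓy-pendant π-ℓy ι≢ℓy t≡ℓy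
    cases (is-ι _ ιu≡t) = n , subst (λ v → Walk (AdjWithout E (ι a) (ι b)) (ι a) v n) (ι-π-image ιu≡t) W

  side-ι : ∀ {a b t} → SideOf E (ι a) (ι b) t ⇔ SideOf E′ a b (π t)
  side-ι = mk⇔ side-project side-lift

  cut-ι : ∀ {a b} → IsCutEdge E (ι a) (ι b) ⇔ IsCutEdge E′ a b
  cut-ι {a} {b} = mk⇔
    (λ (e , disconnected) → trans (sym (ι-adj a b)) e , λ (n , W′) → disconnected (n , walk-map ι lift-AdjWithout W′))
    (λ (e , disconnected) → lift-Adj e , λ side → disconnected (subst (SideOf E′ a b) (π-ι b) (side-project side)))

  ι≢cherry : ∀ {ℓ} → ℓ ≡ ℓx ⊎ ℓ ≡ ℓy → ∀ u → ι u ≢ ℓ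
  ι≢cherry (inj₁ refl) = ι≢ℓx
  ι≢cherry (inj₂ refl) = ι≢ℓy

  p-side : Connected E′ → ∀ {ℓ} → ℓ ≡ ℓx ⊎ ℓ ≡ ℓy → ∀ v → v ≢ ℓ → SideOf E p ℓ v
  p-side conn′ {ℓ} ℓ∈ = kind-elim (λ v → v ≢ ℓ → SideOf E p ℓ v)
    (pendant-neighbour-side ℓx-pendant) (pendant-neighbour-side ℓy-pendant)
    (λ u _ → let (n , W′) = conn′ p′ u in n , walk-map ι avoid W′)
    where
    pendant-neighbour-side : ∀ {ℓ′} → Pendant E ℓ′ p → ℓ′ ≢ ℓ → SideOf E p ℓ ℓ′
    pendant-neighbour-side (ℓ′p , _) ℓ′≢ℓ =
      1 , step (Adj-sym symmetric ℓ′p , ℓ′≢ℓ ∘ proj₂ , ι≢cherry ℓ∈ p′ ∘ proj₁) here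
    avoid : Adj E′ =[ ι ]⇒ AdjWithout E p ℓ
    avoid {u} {v} e = lift-Adj e , ι≢cherry ℓ∈ v ∘ proj₂ , ι≢cherry ℓ∈ u ∘ proj₁

  walk-to-ι-π : ∀ s → ∃[ n ] Walk (Adj E) s (ι (π s)) n
  walk-to-ι-π s = cases (kind s)
    where
    through-pendant : ∀ {ℓ} → Pendant E ℓ p → π ℓ ≡ p′ → s ≡ ℓ → ∃[ n ] Walk (Adj E) s (ι (π s)) n
    through-pendant (ℓp , _) πℓ refl = 1 , step ℓp (subst (λ v → Walk (Adj E) p v 0) (cong ι (sym πℓ)) here)
    cases : Kind s → ∃[ n ] Walk (Adj E) s (ι (π s)) n
    cases (is-ℓx s≡ℓx) = through-pendant ℓx-pendant π-ℓx s≡ℓx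
    cases (is-ℓy s≡ℓy) = through-pendant ℓy-pendant π-ℓy s≡ℓy
    cases (is-ι _ ιu≡s) = 0 , subst (λ v → Walk (Adj E) s v 0) (sym (ι-π-image ιu≡s)) here

  connected-⇔ : Connected E ⇔ Connected E′
  connected-⇔ = mk⇔
    (λ conn u v → let (n′ , _ , W′) = project-walk (proj₂ (conn (ι u) (ι v))) in n′ , W′)
    (λ conn′ s t → _ , walk-++ (proj₂ (walk-to-ι-π s))
                               (walk-++ (lift-walk (proj₂ (conn′ (π s) (π t))))
                                        (walk-reverse (Adj-sym symmetric) (proj₂ (walk-to-ι-π t)))))

module PunchOutPair {k′ : ℕ} {ℓx ℓy : Fin (suc (suc k′))} (ℓx≢ℓy : ℓx ≢ ℓy) where

  j : Fin (suc k′)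
  j = punchOut ℓx≢ℓy

  punchIn-j : punchIn ℓx j ≡ ℓy
  punchIn-j = punchIn-punchOut ℓx≢ℓy

  ι : Fin k′ → Fin (suc (suc k′))
  ι u = punchIn ℓx (punchIn j u)

  restrict : Graph (suc (suc k′)) → Graph k′
  restrict E u v = E (ι u) (ι v)

  ι-injective : ∀ u v → ι u ≡ ι v → u ≡ v
  ι-injective u v ιu≡ιv = punchIn-injective j u v (punchIn-injective ℓx _ _ ιu≡ιv)

  ι≢ℓx : ∀ u → ι u ≢ ℓx
  ι≢ℓx u = punchInᵢ≢i ℓx (punchIn j u)

  ι≢ℓy : ∀ u → ι u ≢ ℓy
  ι≢ℓy u ιu≡ℓy = punchInᵢ≢i j u (punchIn-injective ℓx _ _ (trans ιu≡ℓy (sym punchIn-j)))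

  ι-onto : ∀ v → v ≢ ℓx → v ≢ ℓy → ∃[ u ] ι u ≡ v
  ι-onto v v≢ℓx v≢ℓy = punchOut j≢v′ , trans (cong (punchIn ℓx) (punchIn-punchOut j≢v′)) (punchIn-punchOut ℓx≢v)
    where
    ℓx≢v : ℓx ≢ v
    ℓx≢v = v≢ℓx ∘ sym
    j≢v′ : j ≢ punchOut ℓx≢v
    j≢v′ j≡v′ = v≢ℓy (begin
      v                               ≡⟨ punchIn-punchOut ℓx≢v ⟨
      punchIn ℓx (punchOut ℓx≢v)      ≡⟨ cong (punchIn ℓx) j≡v′ ⟨
      punchIn ℓx j                    ≡⟨ punchIn-j ⟩
      ℓy                              ∎)
      where open ≡-Reasoning

  deg-ι : ∀ (E : Graph (suc (suc k′))) u →
          deg E (ι u) ≡ indicator (E (ι u) ℓx) + (indicator (E (ι u) ℓy) + deg (restrict E) u)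
  deg-ι E u = subst (λ w → deg E (ι u) ≡ indicator (E (ι u) ℓx) + (indicator (E (ι u) w) + deg (restrict E) u))
                    punchIn-j (deg-punchIn² E ℓx j u)

  deletion : ∀ {E : Graph (suc (suc k′))} → Symmetric E →
             ∀ p′ → Pendant E ℓx (ι p′) → Pendant E ℓy (ι p′) → CherryDeletion E (restrict E) ℓx ℓy p′
  deletion E-sym p′ ℓx-pendant ℓy-pendant = record
    { symmetric = E-sym ; ι = ι ; ι-injective = ι-injective ; ι≢ℓx = ι≢ℓx ; ι≢ℓy = ι≢ℓy ; ι-onto = ι-onto
    ; ι-adj = λ _ _ → refl ; ℓx-pendant = ℓx-pendant ; ℓy-pendant = ℓy-pendant ; ℓx≢ℓy = ℓx≢ℓy }

-- Cherries of networks

leaf-pendant : ∀ {X m} (N : Network X m) a {p} → Adj (E N) (label N a) p → Pendant (E N) (label N a) p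
leaf-pendant N a ap = ap , λ w aw → deg≡1⇒neighbour-unique (E N) (label N a) (label-deg N a) w _ aw ap

module Cherry {X : Set} (_≟_ : DecidableEquality X) (x y : X) where

  X′ : Set
  X′ = Reduced _≟_ x y

  Kept : X → Set
  Kept a = T (not ⌊ a ≟ x ⌋ ∧ not ⌊ a ≟ y ⌋)

  kept : ∀ {a} → a ≢ x → a ≢ y → Kept a
  kept {a} a≢x a≢y = from T-∧ (fromWitnessFalse {a? = a ≟ x} a≢x , fromWitnessFalse {a? = a ≟ y} a≢y)

  kept⇒≢x : ∀ {a} → Kept a → a ≢ x
  kept⇒≢x {a} h = toWitnessFalse {a? = a ≟ x} (proj₁ (to (T-∧ {not ⌊ a ≟ x ⌋}) h))

  kept⇒≢y : ∀ {a} → Kept a → a ≢ y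
  kept⇒≢y {a} h = toWitnessFalse {a? = a ≟ y} (proj₂ (to (T-∧ {not ⌊ a ≟ x ⌋}) h))

  kept⇒≢cherry : ∀ {a c} → Kept a → c ≡ x ⊎ c ≡ y → a ≢ c
  kept⇒≢cherry h (inj₁ refl) = kept⇒≢x h
  kept⇒≢cherry h (inj₂ refl) = kept⇒≢y h

  just-cong : ∀ {a b} {h : Kept a} {h′ : Kept b} → a ≡ b → _≡_ {A = X′} (just (a , h)) (just (b , h′))
  just-cong {a} refl = cong (λ h → just (a , h)) (T-irrelevant _ _)

  data Split (a : X) : Set where
    is-x  : a ≡ x → Split a
    is-y  : a ≡ y → Split a
    other : Kept a → Split a

  split : ∀ a → Split a
  split a with a ≟ x | a ≟ y
  ... | yes a≡x | _ = is-x a≡x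
  ... | no _ | yes a≡y = is-y a≡y
  ... | no a≢x | no a≢y = other (kept a≢x a≢y)

  collapse : X → X′
  collapse a with split a
  ... | is-x _ = nothing
  ... | is-y _ = nothing
  ... | other h = just (a , h)

  collapse-cherry : ∀ {c} → c ≡ x ⊎ c ≡ y → collapse c ≡ nothing
  collapse-cherry {c} c∈xy with split c
  ... | is-x _ = refl
  ... | is-y _ = refl
  ... | other h = ⊥-elim (kept⇒≢cherry h c∈xy refl)

  collapse-kept : ∀ {a} (h : Kept a) → collapse a ≡ just (a , h)
  collapse-kept {a} h with split a
  ... | is-x a≡x = ⊥-elim (kept⇒≢x h a≡x)
  ... | is-y a≡y = ⊥-elim (kept⇒≢y h a≡y)
  ... | other _ = just-cong refl

  CherryReduct : ∀ {m m′} → Network X m → Network X′ m′ → Set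
  CherryReduct {m} N N′ = Σ (Fin m) λ p → IsCherry N x y p × CherryReduction _≟_ N x y p N′

  cherryDeletion : ∀ {m m′} {N : Network X m} {N′ : Network X′ m′} → CherryReduct N N′ →
                   CherryDeletion (E N) (E N′) (label N x) (label N y) (label N′ nothing)
  cherryDeletion {N = N} (p , (x≢y , xp , yp) , R) = record
    { symmetric = E-sym N ; ι = ι ; ι-injective = ι-inj
    ; ι≢ℓx = λ u → proj₁ (ι-avoid u) ; ι≢ℓy = λ u → proj₂ (ι-avoid u) ; ι-onto = ι-onto ; ι-adj = ι-adj
    ; ℓx-pendant = leaf-pendant N x (subst (Adj (E N) (label N x)) (sym ι-z) xp)
    ; ℓy-pendant = leaf-pendant N y (subst (Adj (E N) (label N y)) (sym ι-z) yp)
    ; ℓx≢ℓy = x≢y ∘ label-inj N x y }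
    where open CherryReduction R

  module Reduct {m m′} {N : Network X m} {N′ : Network X′ m′} (R : CherryReduct N N′) where
    open CherryDeletionProperties (cherryDeletion R) public

    ι-label : ∀ a h → ι (label N′ (just (a , h))) ≡ label N a
    ι-label = CherryReduction.ι-label (proj₂ (proj₂ R))

    π-label : ∀ a h → π (label N a) ≡ label N′ (just (a , h))
    π-label a h = trans (cong π (sym (ι-label a h))) (π-ι _)

    dist-kept : ∀ {a b h h′ d} →
                Dist (E N′) (label N′ (just (a , h))) (label N′ (just (b , h′))) d ⇔ Dist (E N) (label N a) (label N b) d
    dist-kept {a} {b} {h} {h′} = ⇔-trans (⇔-sym dist-ι) (dist-cong (ι-label a h) (ι-label b h′))

    cherry-pendant : ∀ {c} → c ≡ x ⊎ c ≡ y → Pendant (E N) (label N c) p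
    cherry-pendant (inj₁ refl) = ℓx-pendant
    cherry-pendant (inj₂ refl) = ℓy-pendant

    label≢cherry : ∀ {b c} → Kept b → c ≡ x ⊎ c ≡ y → label N b ≢ label N c
    label≢cherry h c∈xy = kept⇒≢cherry h c∈xy ∘ label-inj N _ _

    dist-cherry : ∀ {b c h d} → c ≡ x ⊎ c ≡ y →
                  Dist (E N′) (label N′ nothing) (label N′ (just (b , h))) d ⇔ Dist (E N) (label N c) (label N b) (suc d)
    dist-cherry {b} {c} {h} {d} c∈xy = begin
      Dist (E N′) (label N′ nothing) (label N′ (just (b , h))) d  ≈⟨ dist-ι ⟨
      Dist (E N) p (ι (label N′ (just (b , h)))) d               ≈⟨ dist-cong refl (ι-label b h) ⟩
      Dist (E N) p (label N b) d
        ≈⟨ dist-from-pendant (cherry-pendant c∈xy) (label≢cherry h c∈xy) ⟨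
      Dist (E N) (label N c) (label N b) (suc d)                  ∎
      where open SetoidReasoning (⇔-setoid 0ℓ)

    ¬dist-cherry-0 : ∀ {b c} → Kept b → c ≡ x ⊎ c ≡ y → ¬ Dist (E N) (label N c) (label N b) 0
    ¬dist-cherry-0 h c∈xy = ¬dist-from-pendant-0 (cherry-pendant c∈xy) (label≢cherry h c∈xy)

    dist-x-y : ∀ {d} → Dist (E N) (label N x) (label N y) d ⇔ d ≡ 2
    dist-x-y = dist-pendant-pendant ℓx-pendant ℓx≢ℓy p≢ℓy (Adj-sym symmetric (proj₁ ℓy-pendant))

  module _ {m m′ k k′} {N : Network X m} {N′ : Network X′ m′} {M : Network X k} {M′ : Network X′ k′}
           (RN : CherryReduct N N′) (RM : CherryReduct M M′) where
    private
      module N = Reduct RN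
      module M = Reduct RM

    sameDist-reduce : SameDistMatrix N M → SameDistMatrix N′ M′
    sameDist-reduce S = entry
      where
      entry : SameDistMatrix N′ M′
      entry nothing nothing d = ⇔-trans dist-self (⇔-sym dist-self)
      entry nothing (just (b , h)) d =
        ⇔-trans (N.dist-cherry (inj₁ refl)) (⇔-trans (S x b (suc d)) (⇔-sym (M.dist-cherry (inj₁ refl))))
      entry (just (a , h)) (just (b , h′)) d = ⇔-trans N.dist-kept (⇔-trans (S a b d) (⇔-sym M.dist-kept))
      entry (just a) nothing d = ⇔-trans (dist-sym (E-sym N′)) (⇔-trans (entry nothing (just a) d) (dist-sym (E-sym M′)))

    Entry : X → X → Set
    Entry a b = ∀ d → Dist (E N) (label N a) (label N b) d ⇔ Dist (E M) (label M a) (label M b) d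

    entry-sym : ∀ {a b} → Entry a b → Entry b a
    entry-sym e d = ⇔-trans (dist-sym (E-sym N)) (⇔-trans (e d) (dist-sym (E-sym M)))

    entry-self : ∀ {a} → Entry a a
    entry-self d = ⇔-trans dist-self (⇔-sym dist-self)

    entry-x-y : Entry x y
    entry-x-y d = ⇔-trans N.dist-x-y (⇔-sym M.dist-x-y)

    module _ (S : SameDistMatrix N′ M′) where

      entry-cherry-kept : ∀ {b c} → c ≡ x ⊎ c ≡ y → Kept b → Entry c b
      entry-cherry-kept c∈xy h zero = mk⇔ (⊥-elim ∘ N.¬dist-cherry-0 h c∈xy) (⊥-elim ∘ M.¬dist-cherry-0 h c∈xy)
      entry-cherry-kept {b} c∈xy h (suc d) =
        ⇔-trans (⇔-sym (N.dist-cherry c∈xy)) (⇔-trans (S nothing (just (b , h)) d) (M.dist-cherry c∈xy))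

      entry-kept : ∀ {a b} → Kept a → Kept b → Entry a b
      entry-kept {a} {b} h h′ d = ⇔-trans (⇔-sym N.dist-kept) (⇔-trans (S (just (a , h)) (just (b , h′)) d) M.dist-kept)

      sameDist-extend : SameDistMatrix N M
      sameDist-extend a b = entry (split a) (split b)
        where
        entry : Split a → Split b → Entry a b
        entry (is-x refl) (is-x refl) = entry-self
        entry (is-y refl) (is-y refl) = entry-self
        entry (is-x refl) (is-y refl) = entry-x-y
        entry (is-y refl) (is-x refl) = entry-sym entry-x-y
        entry (is-x refl) (other h) = entry-cherry-kept (inj₁ refl) h
        entry (is-y refl) (other h) = entry-cherry-kept (inj₂ refl) h
        entry (other h) (is-x refl) = entry-sym (entry-cherry-kept (inj₁ refl) h)
        entry (other h) (is-y refl) = entry-sym (entry-cherry-kept (inj₂ refl) h)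
        entry (other h) (other h′) = entry-kept h h′

  module _ {m m′ k k′} {N : Network X m} {N′ : Network X′ m′} {M : Network X k} {M′ : Network X′ k′}
           (RN : CherryReduct N N′) (RM : CherryReduct M M′) where
    private
      module N = Reduct RN
      module M = Reduct RM

    extendMap : (Fin m′ → Fin k′) → Fin m → Fin k
    extendMap f = N.byKind (label M x) (label M y) (M.ι ∘ f)

    extendMap-x : ∀ f → extendMap f (label N x) ≡ label M x
    extendMap-x f = N.byKind-ℓx (label M x) (label M y) (M.ι ∘ f)

    extendMap-y : ∀ f → extendMap f (label N y) ≡ label M y
    extendMap-y f = N.byKind-ℓy (label M x) (label M y) (M.ι ∘ f)

    extendMap-ι : ∀ f u → extendMap f (N.ι u) ≡ M.ι (f u)
    extendMap-ι f = N.byKind-ι (label M x) (label M y) (M.ι ∘ f)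

    reduceMap : (Fin m → Fin k) → Fin m′ → Fin k′
    reduceMap f = M.π ∘ f ∘ N.ι

    module _ (f : Fin m → Fin k) (x-only : ∀ v → f v ≡ label M x → v ≡ label N x)
                                 (y-only : ∀ v → f v ≡ label M y → v ≡ label N y) where

      reduceMap-ι : ∀ u → M.ι (reduceMap f u) ≡ f (N.ι u)
      reduceMap-ι u = M.ι-π (f (N.ι u)) (N.ι≢ℓx u ∘ x-only _) (N.ι≢ℓy u ∘ y-only _)

  module _ {m m′ k k′} {N : Network X m} {N′ : Network X′ m′} {M : Network X k} {M′ : Network X′ k′}
           (RN : CherryReduct N N′) (RM : CherryReduct M M′) where
    private
      module N = Reduct RN
      module M = Reduct RM

    extendMap-inverse : ∀ {f g} → (∀ u → g (f u) ≡ u) → ∀ v → extendMap RM RN g (extendMap RN RM f v) ≡ v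
    extendMap-inverse {f} {g} gf≗id = N.kind-elim (λ v → extendMap RM RN g (extendMap RN RM f v) ≡ v)
      (trans (cong (extendMap RM RN g) (extendMap-x RN RM f)) (extendMap-x RM RN g))
      (trans (cong (extendMap RM RN g) (extendMap-y RN RM f)) (extendMap-y RM RN g))
      (λ u → trans (cong (extendMap RM RN g) (extendMap-ι RN RM f u))
                   (trans (extendMap-ι RM RN g (f u)) (cong N.ι (gf≗id u))))

    reduceMap-inverse : ∀ {f g} → (∀ v → g (f v) ≡ v) → f (label N x) ≡ label M x → f (label N y) ≡ label M y →
                        ∀ u → reduceMap RM RN g (reduceMap RN RM f u) ≡ u
    reduceMap-inverse {f} {g} gf≗id fx fy u = begin
      N.π (g (M.ι (M.π (f (N.ι u)))))  ≡⟨ cong (N.π ∘ g) (reduceMap-ι RN RM f x-only y-only u) ⟩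
      N.π (g (f (N.ι u)))              ≡⟨ cong N.π (gf≗id (N.ι u)) ⟩
      N.π (N.ι u)                      ≡⟨ N.π-ι u ⟩
      u                                ∎
      where
      open ≡-Reasoning
      x-only : ∀ v → f v ≡ label M x → v ≡ label N x
      x-only v = left-inverse⇒preimage-unique {f = f} {g} gf≗id fx
      y-only : ∀ v → f v ≡ label M y → v ≡ label N y
      y-only v = left-inverse⇒preimage-unique {f = f} {g} gf≗id fy

  module _ {m m′ k k′} {N : Network X m} {N′ : Network X′ m′} {M : Network X k} {M′ : Network X′ k′}
           (RN : CherryReduct N N′) (RM : CherryReduct M M′) where
    private
      module N = Reduct RN
      module M = Reduct RM

    iso-extend : Isomorphic N′ M′ → Isomorphic N M
    iso-extend (φ′ , adj′ , lab′) = mk↔ₛ′ φ ψ (extendMap-inverse RM RN (Inverse.strictlyInverseˡ φ′))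
                                            (extendMap-inverse RN RM (Inverse.strictlyInverseʳ φ′))
                                  , adj , lab
      where
      φ = extendMap RN RM (Inverse.to φ′)
      ψ = extendMap RM RN (Inverse.from φ′)

      φ-injective : ∀ {u v} → φ u ≡ φ v → u ≡ v
      φ-injective {u} {v} φu≡φv = begin
        u          ≡⟨ extendMap-inverse RN RM (Inverse.strictlyInverseʳ φ′) u ⟨
        ψ (φ u)    ≡⟨ cong ψ φu≡φv ⟩
        ψ (φ v)    ≡⟨ extendMap-inverse RN RM (Inverse.strictlyInverseʳ φ′) v ⟩
        v          ∎
        where open ≡-Reasoning

      φ-cherry : ∀ {c} → c ≡ x ⊎ c ≡ y → φ (label N c) ≡ label M c
      φ-cherry (inj₁ refl) = extendMap-x RN RM (Inverse.to φ′)
      φ-cherry (inj₂ refl) = extendMap-y RN RM (Inverse.to φ′)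

      φ-ι : ∀ u → φ (N.ι u) ≡ M.ι (Inverse.to φ′ u)
      φ-ι = extendMap-ι RN RM (Inverse.to φ′)

      φ-p : φ N.p ≡ M.p
      φ-p = trans (φ-ι _) (cong M.ι (lab′ nothing))

      adj-cherry : ∀ {c} → c ≡ x ⊎ c ≡ y → ∀ v → E M (φ (label N c)) (φ v) ≡ E N (label N c) v
      adj-cherry {c} c∈xy v = ⇔→≡ (begin
        E M (φ (label N c)) (φ v) ≡ true  ≈⟨ subst-⇔ (λ w → E M w (φ v) ≡ true) (φ-cherry c∈xy) ⟩
        E M (label M c) (φ v) ≡ true      ≈⟨ pendant-row {E = E M} (M.cherry-pendant c∈xy) ⟩
        φ v ≡ M.p                         ≈⟨ mk⇔ (λ e → φ-injective (trans e (sym φ-p))) (λ { refl → φ-p }) ⟩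
        v ≡ N.p                           ≈⟨ pendant-row {E = E N} (N.cherry-pendant c∈xy) ⟨
        E N (label N c) v ≡ true          ∎)
        where open SetoidReasoning (⇔-setoid 0ℓ)

      adj-ι : ∀ a b → E M (φ (N.ι a)) (φ (N.ι b)) ≡ E N (N.ι a) (N.ι b)
      adj-ι a b = begin
        E M (φ (N.ι a)) (φ (N.ι b))                                ≡⟨ cong₂ (E M) (φ-ι a) (φ-ι b) ⟩
        E M (M.ι (Inverse.to φ′ a)) (M.ι (Inverse.to φ′ b))       ≡⟨ M.ι-adj _ _ ⟩
        E M′ (Inverse.to φ′ a) (Inverse.to φ′ b)                   ≡⟨ adj′ a b ⟩
        E N′ a b                                                   ≡⟨ N.ι-adj a b ⟨
        E N (N.ι a) (N.ι b)                                        ∎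
        where open ≡-Reasoning

      flip-adj : ∀ {u v} → E M (φ v) (φ u) ≡ E N v u → E M (φ u) (φ v) ≡ E N u v
      flip-adj e = trans (E-sym M _ _) (trans e (E-sym N _ _))

      adj : ∀ u v → E M (φ u) (φ v) ≡ E N u v
      adj = N.kind-elim (λ u → ∀ v → E M (φ u) (φ v) ≡ E N u v) (adj-cherry (inj₁ refl)) (adj-cherry (inj₂ refl))
              λ a → N.kind-elim (λ v → E M (φ (N.ι a)) (φ v) ≡ E N (N.ι a) v)
                      (flip-adj (adj-cherry (inj₁ refl) (N.ι a))) (flip-adj (adj-cherry (inj₂ refl) (N.ι a))) (adj-ι a)

      lab : ∀ a → φ (label N a) ≡ label M a
      lab a with split a
      ... | is-x refl = φ-cherry (inj₁ refl)
      ... | is-y refl = φ-cherry (inj₂ refl)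
      ... | other h = begin
        φ (label N a)                           ≡⟨ cong φ (N.ι-label a h) ⟨
        φ (N.ι (label N′ (just (a , h))))        ≡⟨ φ-ι _ ⟩
        M.ι (Inverse.to φ′ (label N′ (just (a , h)))) ≡⟨ cong M.ι (lab′ _) ⟩
        M.ι (label M′ (just (a , h)))            ≡⟨ M.ι-label a h ⟩
        label M a                               ∎
        where open ≡-Reasoning

    iso-reduce : Isomorphic N M → Isomorphic N′ M′
    iso-reduce (φ , adj , lab) =
      mk↔ₛ′ φ′ ψ′ (reduceMap-inverse RM RN {g} {f} (Inverse.strictlyInverseˡ φ) (from-label x) (from-label y))
                  (reduceMap-inverse RN RM {f} {g} (Inverse.strictlyInverseʳ φ) (lab x) (lab y))
      , adj′ , lab′
      where
      f = Inverse.to φ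
      g = Inverse.from φ
      φ′ = reduceMap RN RM f
      ψ′ = reduceMap RM RN g

      from-label : ∀ a → Inverse.from φ (label M a) ≡ label N a
      from-label a = trans (cong (Inverse.from φ) (sym (lab a))) (Inverse.strictlyInverseʳ φ _)

      ι-φ′ : ∀ u → M.ι (φ′ u) ≡ f (N.ι u)
      ι-φ′ = reduceMap-ι RN RM f (λ v → left-inverse⇒preimage-unique {f = f} {g} (Inverse.strictlyInverseʳ φ) (lab x))
                                 (λ v → left-inverse⇒preimage-unique {f = f} {g} (Inverse.strictlyInverseʳ φ) (lab y))

      adj′ : ∀ u v → E M′ (φ′ u) (φ′ v) ≡ E N′ u v
      adj′ u v = begin
        E M′ (φ′ u) (φ′ v)               ≡⟨ M.ι-adj _ _ ⟨
        E M (M.ι (φ′ u)) (M.ι (φ′ v))    ≡⟨ cong₂ (E M) (ι-φ′ u) (ι-φ′ v) ⟩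
        E M (f (N.ι u)) (f (N.ι v))      ≡⟨ adj _ _ ⟩
        E N (N.ι u) (N.ι v)              ≡⟨ N.ι-adj u v ⟩
        E N′ u v                         ∎
        where open ≡-Reasoning

      f-p : f N.p ≡ M.p
      f-p = proj₂ M.ℓx-pendant (f N.p) (begin
        E M (label M x) (f N.p)   ≡⟨ cong (λ w → E M w (f N.p)) (lab x) ⟨
        E M (f (label N x)) (f N.p) ≡⟨ adj _ _ ⟩
        E N (label N x) N.p       ≡⟨ proj₁ N.ℓx-pendant ⟩
        true                      ∎)
        where open ≡-Reasoning

      lab′ : ∀ r → φ′ (label N′ r) ≡ label M′ r
      lab′ nothing = trans (cong M.π f-p) (M.π-ι _)
      lab′ (just (a , h)) = begin
        M.π (f (N.ι (label N′ (just (a , h)))))   ≡⟨ cong (M.π ∘ f) (N.ι-label a h) ⟩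
        M.π (f (label N a))                      ≡⟨ cong M.π (lab a) ⟩
        M.π (label M a)                          ≡⟨ M.π-label a h ⟩
        label M′ (just (a , h))                  ∎
        where open ≡-Reasoning

  module Reduction (x≢y : x ≢ y) (c : X) (c-kept : Kept c) {k′} (M : Network X (suc (suc k′)))
                   {q} (xq : Adj (E M) (label M x) q) (yq : Adj (E M) (label M y) q) where

    x≢y-labels : label M x ≢ label M y
    x≢y-labels = x≢y ∘ label-inj M x y

    open PunchOutPair x≢y-labels using (restrict; deg-ι; deletion)

    E′ : Graph k′
    E′ = restrict (E M)

    adj⇒≢ : ∀ {u v} → Adj (E M) u v → v ≢ u
    adj⇒≢ {u} uv refl with () ← trans (sym uv) (E-irrefl M u)

    q′ : Fin k′
    q′ = proj₁ (PunchOutPair.ι-onto x≢y-labels q (adj⇒≢ xq) (adj⇒≢ yq))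

    ι-q′ : PunchOutPair.ι x≢y-labels q′ ≡ q
    ι-q′ = proj₂ (PunchOutPair.ι-onto x≢y-labels q (adj⇒≢ xq) (adj⇒≢ yq))

    D : CherryDeletion (E M) E′ (label M x) (label M y) q′
    D = deletion (E-sym M) q′ (leaf-pendant M x (subst (Adj (E M) (label M x)) (sym ι-q′) xq))
                              (leaf-pendant M y (subst (Adj (E M) (label M y)) (sym ι-q′) yq))

    open CherryDeletionProperties D

    -- a leaf adjacent to both ℓx and ℓy would have degree at least 2
    label≢p : ∀ a → label M a ≢ p
    label≢p a a≡p = ℓx≢ℓy (deg≡1⇒neighbour-unique (E M) (label M a) (label-deg M a) _ _
                            (subst (λ v → Adj (E M) v (label M x)) (sym a≡p) (Adj-sym (E-sym M) (proj₁ ℓx-pendant)))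
                            (subst (λ v → Adj (E M) v (label M y)) (sym a≡p) (Adj-sym (E-sym M) (proj₁ ℓy-pendant))))

    deg-p : deg (E M) p ≡ 3
    deg-p with other-deg M p
    ... | inj₁ (a , label≡p) = ⊥-elim (label≢p a label≡p)
    ... | inj₂ deg≡3 = deg≡3

    deg′-q′ : deg E′ q′ ≡ 1
    deg′-q′ = suc-injective (suc-injective (begin
      2 + deg E′ q′
        ≡⟨ cong₂ (λ i j → i + (j + deg E′ q′)) (adjacent ℓx-pendant) (adjacent ℓy-pendant) ⟨
      indicator (E M p (label M x)) + (indicator (E M p (label M y)) + deg E′ q′)
        ≡⟨ deg-ι (E M) q′ ⟨
      deg (E M) p
        ≡⟨ deg-p ⟩
      3 ∎))
      where
      open ≡-Reasoning
      adjacent : ∀ {ℓ} → Pendant (E M) ℓ p → indicator (E M p ℓ) ≡ 1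
      adjacent (ℓp , _) = indicator-true (Adj-sym symmetric ℓp)

    deg′≡deg : ∀ u → ι u ≢ p → deg E′ u ≡ deg (E M) (ι u)
    deg′≡deg u ιu≢p = sym (trans (deg-ι (E M) u)
      (cong₂ (λ i j → i + (j + deg E′ u)) (not-adjacent ℓx-pendant) (not-adjacent ℓy-pendant)))
      where
      not-adjacent : ∀ {ℓ} → Pendant (E M) ℓ p → indicator (E M (ι u) ℓ) ≡ 0
      not-adjacent (_ , only-p) = indicator-false (ιu≢p ∘ only-p _ ∘ Adj-sym (E-sym M))

    label′ : X′ → Fin k′
    label′ nothing = q′
    label′ (just (a , _)) = π (label M a)

    ι-label′ : ∀ a h → ι (label′ (just (a , h))) ≡ label M a
    ι-label′ a h = ι-π (label M a) (kept⇒≢x h ∘ label-inj M a x) (kept⇒≢y h ∘ label-inj M a y)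

    π-label : ∀ a → π (label M a) ≡ label′ (collapse a)
    π-label a with split a
    ... | is-x refl = π-ℓx
    ... | is-y refl = π-ℓy
    ... | other h = refl

    label′-inj : ∀ r s → label′ r ≡ label′ s → r ≡ s
    label′-inj nothing nothing _ = refl
    label′-inj nothing (just (b , h)) q′≡ = ⊥-elim (label≢p b (trans (sym (ι-label′ b h)) (cong ι (sym q′≡))))
    label′-inj (just (a , h)) nothing ≡q′ = ⊥-elim (label≢p a (trans (sym (ι-label′ a h)) (cong ι ≡q′)))
    label′-inj (just (a , h)) (just (b , h′)) eq = just-cong (label-inj M a b (begin
      label M a                 ≡⟨ ι-label′ a h ⟨
      ι (label′ (just (a , h)))   ≡⟨ cong ι eq ⟩
      ι (label′ (just (b , h′)))  ≡⟨ ι-label′ b h′ ⟩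
      label M b                 ∎))
      where open ≡-Reasoning

    label′-deg : ∀ r → deg E′ (label′ r) ≡ 1
    label′-deg nothing = deg′-q′
    label′-deg (just (a , h)) = begin
      deg E′ (π (label M a))          ≡⟨ deg′≡deg _ (subst (_≢ p) (sym (ι-label′ a h)) (label≢p a)) ⟩
      deg (E M) (ι (π (label M a)))   ≡⟨ cong (deg (E M)) (ι-label′ a h) ⟩
      deg (E M) (label M a)           ≡⟨ label-deg M a ⟩
      1                               ∎
      where open ≡-Reasoning

    other-deg′ : ∀ u → (∃[ r ] label′ r ≡ u) ⊎ (deg E′ u ≡ 3)
    other-deg′ u with other-deg M (ι u)
    ... | inj₁ (a , label≡ιu) = inj₁ (collapse a , trans (sym (π-label a)) (trans (cong π label≡ιu) (π-ι u)))
    ... | inj₂ deg≡3 with ι u ≟ᶠ p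
    ...   | yes ιu≡p = inj₁ (nothing , ι-injective q′ u (sym ιu≡p))
    ...   | no ιu≢p = inj₂ (trans (deg′≡deg u ιu≢p) deg≡3)

    side-label : ∀ {a b} t → SideOf (E M) (ι a) (ι b) (label M t) ⇔ SideOf E′ a b (label′ (collapse t))
    side-label {a} {b} t = ⇔-trans side-ι (subst-⇔ (SideOf E′ a b) (π-label t))

    cut-nonempty′ : ∀ u v → IsCutEdge E′ u v →
                    (∃[ r ] SideOf E′ u v (label′ r)) × (∃[ r ] SideOf E′ v u (label′ r))
    cut-nonempty′ u v cut′ with cut-nonempty M (ι u) (ι v) (from cut-ι cut′)
    ... | (a , a-side) , (b , b-side) =
      (collapse a , to (side-label a) a-side) , (collapse b , to (side-label b) b-side)

    lift-bipartition : ∀ {a b a′ b′} → SameBipartition E′ label′ a b a′ b′ →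
                       SameBipartition (E M) (label M) (ι a) (ι b) (ι a′) (ι b′)
    lift-bipartition H t = ⇔-trans (side-label t) (⇔-trans (H (collapse t)) (⇔-sym (side-label t)))

    cut-distinct′ : ∀ u v u′ v′ → IsCutEdge E′ u v → IsCutEdge E′ u′ v′ →
                    SameBipartition E′ label′ u v u′ v′ ⊎ SameBipartition E′ label′ u v v′ u′ →
                    (u ≡ u′ × v ≡ v′) ⊎ (u ≡ v′ × v ≡ u′)
    cut-distinct′ u v u′ v′ cut cut′ H =
      map⊎ (map× (ι-injective _ _) (ι-injective _ _)) (map× (ι-injective _ _) (ι-injective _ _))
           (cut-distinct M _ _ _ _ (from cut-ι cut) (from cut-ι cut′) (map⊎ lift-bipartition lift-bipartition H))

    M′ : Network X′ k′
    M′ = record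
      { E = E′
      ; E-sym = λ u v → E-sym M (ι u) (ι v)
      ; E-irrefl = λ v → E-irrefl M (ι v)
      ; connected = to connected-⇔ (connected M)
      ; label = label′
      ; label-inj = label′-inj
      ; label-deg = label′-deg
      ; other-deg = other-deg′
      ; two-leaves = nothing , just (c , c-kept) , λ ()
      ; cut-nonempty = cut-nonempty′
      ; cut-distinct = cut-distinct′
      }

    reduct : CherryReduct M M′
    reduct = q , (x≢y , xq , yq) , record
      { ι = ι ; ι-inj = ι-injective ; ι-avoid = λ u → ι≢ℓx u , ι≢ℓy u ; ι-onto = ι-onto
      ; ι-adj = λ _ _ → refl ; ι-z = ι-q′ ; ι-label = ι-label′ }

  reduce : x ≢ y → (c : X) → Kept c → ∀ {k} (M : Network X k) {q} →
           Adj (E M) (label M x) q → Adj (E M) (label M y) q → ∃[ k′ ] Σ (Network X′ k′) (CherryReduct M)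
  reduce x≢y c c-kept {suc zero} M _ _ = ⊥-elim (x≢y (label-inj M x y (Fin1-unique _ _)))
    where
    Fin1-unique : (i j : Fin 1) → i ≡ j
    Fin1-unique zero zero = refl
  reduce x≢y c c-kept {suc (suc k′)} M xq yq = k′ , M′ , reduct
    where open Reduction x≢y c c-kept M xq yq

  module Extension (x≢y : x ≢ y) (c₀ : X) (c₀-kept : Kept c₀) {k′} (M′ : Network X′ k′) where

    z : Fin k′
    z = label M′ nothing

    at-z : Fin k′ → Bool
    at-z v = does (v ≟ᶠ z)

    -- vertices 0 and 1 are the new leaves x and y, both attached to the vertex of z
    E⁺ : Graph (suc (suc k′))
    E⁺ (suc (suc u)) (suc (suc v)) = E M′ u v
    E⁺ (suc (suc u)) _ = at-z u
    E⁺ _ (suc (suc v)) = at-z v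
    E⁺ _ _ = false

    E⁺-sym : Symmetric E⁺
    E⁺-sym (suc (suc u)) (suc (suc v)) = E-sym M′ u v
    E⁺-sym (suc (suc u)) zero = refl
    E⁺-sym (suc (suc u)) (suc zero) = refl
    E⁺-sym zero (suc (suc v)) = refl
    E⁺-sym (suc zero) (suc (suc v)) = refl
    E⁺-sym zero zero = refl
    E⁺-sym zero (suc zero) = refl
    E⁺-sym (suc zero) zero = refl
    E⁺-sym (suc zero) (suc zero) = refl

    E⁺-irrefl : ∀ v → E⁺ v v ≡ false
    E⁺-irrefl zero = refl
    E⁺-irrefl (suc zero) = refl
    E⁺-irrefl (suc (suc v)) = E-irrefl M′ v

    new-leaf-pendant : ∀ ℓ → ℓ ≡ zero ⊎ ℓ ≡ suc zero → Pendant E⁺ ℓ (suc (suc z))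
    new-leaf-pendant ℓ ℓ∈ = subst (λ b → b ≡ true) (sym (row-z ℓ∈)) (dec-true (z ≟ᶠ z) refl) , only-z ℓ∈
      where
      row-z : ∀ {ℓ} → ℓ ≡ zero ⊎ ℓ ≡ suc zero → E⁺ ℓ (suc (suc z)) ≡ at-z z
      row-z (inj₁ refl) = refl
      row-z (inj₂ refl) = refl
      only-z : ∀ {ℓ} → ℓ ≡ zero ⊎ ℓ ≡ suc zero → ∀ w → Adj E⁺ ℓ w → w ≡ suc (suc z)
      only-z (inj₁ refl) (suc (suc w)) e = cong (λ w → suc (suc w)) (does-true (w ≟ᶠ z) e)
      only-z (inj₂ refl) (suc (suc w)) e = cong (λ w → suc (suc w)) (does-true (w ≟ᶠ z) e)

    open PunchOutPair {k′} {ℓx = zero} {ℓy = suc zero} (λ ()) using (deg-ι; deletion)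

    open CherryDeletionProperties
      (deletion E⁺-sym z (new-leaf-pendant zero (inj₁ refl)) (new-leaf-pendant (suc zero) (inj₂ refl)))

    label⁺ : X → Fin (suc (suc k′))
    label⁺ a with split a
    ... | is-x _ = zero
    ... | is-y _ = suc zero
    ... | other h = ι (label M′ (just (a , h)))

    label⁺-x : label⁺ x ≡ zero
    label⁺-x with split x
    ... | is-x _ = refl
    ... | is-y x≡y = ⊥-elim (x≢y x≡y)
    ... | other h = ⊥-elim (kept⇒≢x h refl)

    label⁺-y : label⁺ y ≡ suc zero
    label⁺-y with split y
    ... | is-x y≡x = ⊥-elim (x≢y (sym y≡x))
    ... | is-y _ = refl
    ... | other h = ⊥-elim (kept⇒≢y h refl)

    label⁺-kept : ∀ {a} (h : Kept a) → label⁺ a ≡ ι (label M′ (just (a , h)))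
    label⁺-kept {a} h with split a
    ... | is-x a≡x = ⊥-elim (kept⇒≢x h a≡x)
    ... | is-y a≡y = ⊥-elim (kept⇒≢y h a≡y)
    ... | other h′ = cong (ι ∘ label M′) (just-cong refl)

    label⁺-cherry : ∀ {c} → c ≡ x ⊎ c ≡ y → label⁺ c ≡ zero ⊎ label⁺ c ≡ suc zero
    label⁺-cherry (inj₁ refl) = inj₁ label⁺-x
    label⁺-cherry (inj₂ refl) = inj₂ label⁺-y

    π-label⁺ : ∀ t → π (label⁺ t) ≡ label M′ (collapse t)
    π-label⁺ t with split t
    ... | is-x _ = π-ℓx
    ... | is-y _ = π-ℓy
    ... | other h = π-ι _

    label⁺-inj : ∀ a b → label⁺ a ≡ label⁺ b → a ≡ b
    label⁺-inj a b eq with split a | split b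
    ... | is-x a≡x | is-x b≡x = trans a≡x (sym b≡x)
    ... | is-y a≡y | is-y b≡y = trans a≡y (sym b≡y)
    ... | other h | other h′ = cong (maybe proj₁ a) (label-inj M′ _ _ (Fin.suc-injective (Fin.suc-injective eq)))
    label⁺-inj a b () | is-x _ | is-y _
    label⁺-inj a b () | is-x _ | other _
    label⁺-inj a b () | is-y _ | is-x _
    label⁺-inj a b () | is-y _ | other _
    label⁺-inj a b () | other _ | is-x _
    label⁺-inj a b () | other _ | is-y _

    deg⁺-ι : ∀ u → deg E⁺ (ι u) ≡ indicator (at-z u) + (indicator (at-z u) + deg (E M′) u)
    deg⁺-ι = deg-ι E⁺

    deg⁺-new-leaf : ∀ {ℓ} → ℓ ≡ zero ⊎ ℓ ≡ suc zero → deg E⁺ ℓ ≡ 1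
    deg⁺-new-leaf (inj₁ refl) = trans (deg≡sum E⁺ zero) (sum-indicator-≟ z)
    deg⁺-new-leaf (inj₂ refl) = trans (deg≡sum E⁺ (suc zero)) (sum-indicator-≟ z)

    deg⁺-away : ∀ u → u ≢ z → deg E⁺ (ι u) ≡ deg (E M′) u
    deg⁺-away u u≢z =
      trans (deg⁺-ι u) (cong (λ b → indicator b + (indicator b + deg (E M′) u)) (dec-false (u ≟ᶠ z) u≢z))

    deg⁺-z : deg E⁺ (ι z) ≡ 3
    deg⁺-z =
      trans (deg⁺-ι z) (cong₂ (λ b d → indicator b + (indicator b + d)) (dec-true (z ≟ᶠ z) refl) (label-deg M′ nothing))

    label⁺-deg : ∀ a → deg E⁺ (label⁺ a) ≡ 1
    label⁺-deg a with split a
    ... | is-x _ = deg⁺-new-leaf (inj₁ refl)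
    ... | is-y _ = deg⁺-new-leaf (inj₂ refl)
    ... | other h = trans (deg⁺-away _ (λ eq → just≢nothing (label-inj M′ _ _ eq))) (label-deg M′ _)
      where
      just≢nothing : ∀ {r} → _≡_ {A = X′} (just r) nothing → ⊥
      just≢nothing ()

    other-deg⁺ : ∀ v → (∃[ a ] label⁺ a ≡ v) ⊎ (deg E⁺ v ≡ 3)
    other-deg⁺ zero = inj₁ (x , label⁺-x)
    other-deg⁺ (suc zero) = inj₁ (y , label⁺-y)
    other-deg⁺ (suc (suc u)) with other-deg M′ u
    ... | inj₁ (nothing , refl) = inj₂ deg⁺-z
    ... | inj₁ (just (a , h) , label≡u) = inj₁ (a , trans (label⁺-kept h) (cong ι label≡u))
    ... | inj₂ deg≡3 = inj₂ (trans (deg⁺-away u u≢z) deg≡3)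
      where
      u≢z : u ≢ z
      u≢z refl with () ← trans (sym deg≡3) (label-deg M′ nothing)

    pendant⁺ : ∀ {c} → c ≡ x ⊎ c ≡ y → Pendant E⁺ (label⁺ c) p
    pendant⁺ (inj₁ refl) = subst (λ ℓ → Pendant E⁺ ℓ p) (sym label⁺-x) ℓx-pendant
    pendant⁺ (inj₂ refl) = subst (λ ℓ → Pendant E⁺ ℓ p) (sym label⁺-y) ℓy-pendant

    side-outward : ∀ {c} → c ≡ x ⊎ c ≡ y → ∀ t → SideOf E⁺ (label⁺ c) p (label⁺ t) ⇔ t ≡ c
    side-outward c∈xy t = mk⇔ (label⁺-inj _ _ ∘ pendant-side (pendant⁺ c∈xy)) (λ { refl → 0 , here })

    side-inward : ∀ {c} → c ≡ x ⊎ c ≡ y → ∀ t → SideOf E⁺ p (label⁺ c) (label⁺ t) ⇔ t ≢ c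
    side-inward c∈xy t = mk⇔
      (λ side t≡c → ¬pendant-opposite-side (pendant⁺ c∈xy) E⁺-sym (ι≢cherry (label⁺-cherry c∈xy) _)
                      (subst (λ t → SideOf E⁺ p (label⁺ _) (label⁺ t)) t≡c side))
      (λ t≢c → p-side (connected M′) (label⁺-cherry c∈xy) (label⁺ t) (t≢c ∘ label⁺-inj t _))

    c₀-inward : ∀ {c} → c ≡ x ⊎ c ≡ y → SideOf E⁺ p (label⁺ c) (label⁺ c₀)
    c₀-inward c∈xy = from (side-inward c∈xy c₀) (kept⇒≢cherry c₀-kept c∈xy)

    c₀-not-outward : ∀ {c} → c ≡ x ⊎ c ≡ y → ¬ SideOf E⁺ (label⁺ c) p (label⁺ c₀)
    c₀-not-outward c∈xy = kept⇒≢cherry c₀-kept c∈xy ∘ to (side-outward c∈xy c₀)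

    side-label⁺ : ∀ {a b} t → SideOf E⁺ (ι a) (ι b) (label⁺ t) ⇔ SideOf (E M′) a b (label M′ (collapse t))
    side-label⁺ {a} {b} t = ⇔-trans side-ι (subst-⇔ (SideOf (E M′) a b) (π-label⁺ t))

    inner-x⇔y : ∀ {a b} → SideOf E⁺ (ι a) (ι b) (label⁺ x) ⇔ SideOf E⁺ (ι a) (ι b) (label⁺ y)
    inner-x⇔y {a} {b} =
      ⇔-trans (side-label⁺ x) (⇔-trans (subst-⇔ (SideOf (E M′) a b ∘ label M′) x↦y) (⇔-sym (side-label⁺ y)))
      where
      x↦y : collapse x ≡ collapse y
      x↦y = trans (collapse-cherry (inj₁ refl)) (sym (collapse-cherry (inj₂ refl)))

    expand : X′ → X
    expand nothing = x
    expand (just (a , _)) = a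

    collapse-expand : ∀ r → collapse (expand r) ≡ r
    collapse-expand nothing = collapse-cherry (inj₁ refl)
    collapse-expand (just (a , h)) = collapse-kept h

    side-expand : ∀ {a b} r → SideOf E⁺ (ι a) (ι b) (label⁺ (expand r)) ⇔ SideOf (E M′) a b (label M′ r)
    side-expand {a} {b} r =
      ⇔-trans (side-label⁺ (expand r)) (subst-⇔ (SideOf (E M′) a b ∘ label M′) (collapse-expand r))

    outward-separates : ∀ {c} → c ≡ x ⊎ c ≡ y →
                        ¬ (SideOf E⁺ (label⁺ c) p (label⁺ x) ⇔ SideOf E⁺ (label⁺ c) p (label⁺ y))
    outward-separates c∈xy H
      with ⇔-trans (⇔-sym (side-outward c∈xy x)) (⇔-trans H (side-outward c∈xy y)) | c∈xy
    ... | x≡c⇔y≡c | inj₁ refl = x≢y (sym (to x≡c⇔y≡c refl))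
    ... | x≡c⇔y≡c | inj₂ refl = x≢y (from x≡c⇔y≡c refl)

    inward-separates : ∀ {c} → c ≡ x ⊎ c ≡ y →
                       ¬ (SideOf E⁺ p (label⁺ c) (label⁺ x) ⇔ SideOf E⁺ p (label⁺ c) (label⁺ y))
    inward-separates c∈xy H
      with ⇔-trans (⇔-sym (side-inward c∈xy x)) (⇔-trans H (side-inward c∈xy y)) | c∈xy
    ... | x≢c⇔y≢c | inj₁ refl = from x≢c⇔y≢c (x≢y ∘ sym) refl
    ... | x≢c⇔y≢c | inj₂ refl = to x≢c⇔y≢c x≢y refl

    data CutKind (u v : Fin (suc (suc k′))) : Set where
      outward : ∀ {c} → c ≡ x ⊎ c ≡ y → u ≡ label⁺ c → v ≡ p → CutKind u v
      inward  : ∀ {c} → c ≡ x ⊎ c ≡ y → u ≡ p → v ≡ label⁺ c → CutKind u v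
      inner   : ∀ a b → u ≡ ι a → v ≡ ι b → IsCutEdge (E M′) a b → CutKind u v

    cutKind : ∀ u v → IsCutEdge E⁺ u v → CutKind u v
    cutKind zero (suc (suc w)) (e , _) = outward (inj₁ refl) (sym label⁺-x) (cong ι (does-true (w ≟ᶠ z) e))
    cutKind (suc zero) (suc (suc w)) (e , _) = outward (inj₂ refl) (sym label⁺-y) (cong ι (does-true (w ≟ᶠ z) e))
    cutKind (suc (suc w)) zero (e , _) = inward (inj₁ refl) (cong ι (does-true (w ≟ᶠ z) e)) (sym label⁺-x)
    cutKind (suc (suc w)) (suc zero) (e , _) = inward (inj₂ refl) (cong ι (does-true (w ≟ᶠ z) e)) (sym label⁺-y)
    cutKind (suc (suc a)) (suc (suc b)) cut = inner a b refl refl (to cut-ι cut)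
    cutKind zero zero (() , _)
    cutKind zero (suc zero) (() , _)
    cutKind (suc zero) zero (() , _)
    cutKind (suc zero) (suc zero) (() , _)

    -- The labels x, y and c₀ tell the pendant cut-edges apart; inner cut-edges never separate x from y.
    same-cut : ∀ {u v u′ v′} → CutKind u v → CutKind u′ v′ → SameBipartition E⁺ label⁺ u v u′ v′ →
               (u ≡ u′ × v ≡ v′) ⊎ (u ≡ v′ × v ≡ u′)
    same-cut (outward {c} c∈xy refl refl) (outward c′∈xy refl refl) H =
      inj₁ (cong label⁺ (to (side-outward c′∈xy c) (to (H c) (from (side-outward c∈xy c) refl))) , refl)
    same-cut (outward c∈xy refl refl) (inward c′∈xy refl refl) H =
      ⊥-elim (c₀-not-outward c∈xy (from (H c₀) (c₀-inward c′∈xy)))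
    same-cut (inward c∈xy refl refl) (outward c′∈xy refl refl) H =
      ⊥-elim (c₀-not-outward c′∈xy (to (H c₀) (c₀-inward c∈xy)))
    same-cut (inward {c} c∈xy refl refl) (inward {c′} c′∈xy refl refl) H =
      inj₁ (refl , cong label⁺ (decidable-stable (c ≟ c′) ¬c≢c′))
      where
      ¬c≢c′ : ¬ c ≢ c′
      ¬c≢c′ c≢c′ = to (side-inward c∈xy c) (from (H c) (from (side-inward c′∈xy c) c≢c′)) refl
    same-cut (outward c∈xy refl refl) (inner _ _ refl refl _) H =
      ⊥-elim (outward-separates c∈xy (⇔-trans (H x) (⇔-trans inner-x⇔y (⇔-sym (H y)))))
    same-cut (inward c∈xy refl refl) (inner _ _ refl refl _) H =
      ⊥-elim (inward-separates c∈xy (⇔-trans (H x) (⇔-trans inner-x⇔y (⇔-sym (H y)))))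
    same-cut (inner _ _ refl refl _) (outward c∈xy refl refl) H =
      ⊥-elim (outward-separates c∈xy (⇔-trans (⇔-sym (H x)) (⇔-trans inner-x⇔y (H y))))
    same-cut (inner _ _ refl refl _) (inward c∈xy refl refl) H =
      ⊥-elim (inward-separates c∈xy (⇔-trans (⇔-sym (H x)) (⇔-trans inner-x⇔y (H y))))
    same-cut (inner a b refl refl cut) (inner a′ b′ refl refl cut′) H =
      map⊎ (map× (cong ι) (cong ι)) (map× (cong ι) (cong ι)) (cut-distinct M′ a b a′ b′ cut cut′ (inj₁ H′))
      where
      H′ : SameBipartition (E M′) (label M′) a b a′ b′
      H′ r = ⇔-trans (⇔-sym (side-expand r)) (⇔-trans (H (expand r)) (side-expand r))

    cut-distinct⁺ : ∀ u v u′ v′ → IsCutEdge E⁺ u v → IsCutEdge E⁺ u′ v′ →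
                    SameBipartition E⁺ label⁺ u v u′ v′ ⊎ SameBipartition E⁺ label⁺ u v v′ u′ →
                    (u ≡ u′ × v ≡ v′) ⊎ (u ≡ v′ × v ≡ u′)
    cut-distinct⁺ u v u′ v′ cut cut′ (inj₁ H) = same-cut (cutKind u v cut) (cutKind u′ v′ cut′) H
    cut-distinct⁺ u v u′ v′ cut cut′ (inj₂ H) =
      swap (same-cut (cutKind u v cut) (cutKind v′ u′ (IsCutEdge-sym E⁺-sym cut′)) H)

    cut-nonempty⁺ : ∀ u v → IsCutEdge E⁺ u v →
                    (∃[ a ] SideOf E⁺ u v (label⁺ a)) × (∃[ b ] SideOf E⁺ v u (label⁺ b))
    cut-nonempty⁺ u v cut with cutKind u v cut
    ... | outward {c} c∈xy refl refl = (c , from (side-outward c∈xy c) refl) , (c₀ , c₀-inward c∈xy)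
    ... | inward {c} c∈xy refl refl = (c₀ , c₀-inward c∈xy) , (c , from (side-outward c∈xy c) refl)
    ... | inner a b refl refl cut′ with cut-nonempty M′ a b cut′
    ...   | (r , r-side) , (r′ , r′-side) =
      (expand r , from (side-expand r) r-side) , (expand r′ , from (side-expand r′) r′-side)

    M : Network X (suc (suc k′))
    M = record
      { E = E⁺
      ; E-sym = E⁺-sym
      ; E-irrefl = E⁺-irrefl
      ; connected = from connected-⇔ (connected M′)
      ; label = label⁺
      ; label-inj = label⁺-inj
      ; label-deg = label⁺-deg
      ; other-deg = other-deg⁺
      ; two-leaves = x , y , x≢y
      ; cut-nonempty = cut-nonempty⁺
      ; cut-distinct = cut-distinct⁺
      }

    reduct : CherryReduct M M′
    reduct = p , (x≢y , proj₁ (pendant⁺ (inj₁ refl)) , proj₁ (pendant⁺ (inj₂ refl))) , record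
      { ι = ι
      ; ι-inj = ι-injective
      ; ι-avoid = λ u → subst (ι u ≢_) (sym label⁺-x) (ι≢ℓx u) , subst (ι u ≢_) (sym label⁺-y) (ι≢ℓy u)
      ; ι-onto = λ v v≢x v≢y → ι-onto v (λ v≡0 → v≢x (trans v≡0 (sym label⁺-x))) (λ v≡1 → v≢y (trans v≡1 (sym label⁺-y)))
      ; ι-adj = λ _ _ → refl
      ; ι-z = refl
      ; ι-label = λ a h → sym (label⁺-kept h)
      }

lemma1 : {X : Set} (_≟_ : DecidableEquality X) {m m' : ℕ}
         (N : Network X m) (x y : X) (p : Fin m) → IsCherry N x y p →
         (N' : Network (Reduced _≟_ x y) m') → CherryReduction _≟_ N x y p N' →
         Reconstructible N ⇔ Reconstructible N'
lemma1 {X} _≟_ N x y p cherry@(x≢y , _) N′ R = mk⇔ forward backward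
  where
  open Cherry _≟_ x y

  RN : CherryReduct N N′
  RN = p , cherry , R

  -- a label outside the cherry, which exists because N′ has two leaves
  third : Σ X Kept
  third with two-leaves N′
  ... | just c , _ = c
  ... | nothing , just c , _ = c
  ... | nothing , nothing , z≢z = ⊥-elim (z≢z refl)

  forward : Reconstructible N → Reconstructible N′
  forward reconstructible M′ S′ = iso-reduce RN RM (reconstructible M (sameDist-extend RN RM S′))
    where open Extension x≢y (proj₁ third) (proj₂ third) M′ renaming (reduct to RM)

  backward : Reconstructible N′ → Reconstructible N
  backward reconstructible M S with to (S x y 2) (from (Reduct.dist-x-y RN) refl)
  ... | step xq (step qy here) , _ with reduce x≢y (proj₁ third) (proj₂ third) M xq (Adj-sym (E-sym M) qy)
  ...   | _ , M′ , RM = iso-extend RN RM (reconstructible M′ (sameDist-reduce RN RM S))
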